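{- Let $W$ be a neat, upward-restricted layered wheel. Then the class of finite induced subgraphs of $W$ has bounded twin-width.
   Context: A layered wheel is a countably infinite graph $G$ on the same vertex set as a countably infinite, locally finite, planarly embedded rooted tree $T$ such that: (1) for every natural number $n$, the set $L_n$ of nodes at distance $n$ from the root in $T$ induces in $G$ a path going left-to-right in the planar embedding of $T$; these are the layer edges, forming the set $E_L$; (2) every edge in $E(G)\setminus E_L$ joins a pair of nodes one of which is an ancestor of the other in $T$; (3) there is a bound on the length of paths in $T$ consisting only of vertices of degree 2 in $T$. Every node is its own ancestor and descendant. The layered wheel is neat if $T$ has no leaf. It is upward-restricted if there is an integer $t$ such that for every node $v$ of $T$ there is a set $X_v$ of at most $t$ ancestors of $v$ such that, in $G - E_L$, every edge with exactly one endpoint among the descendants of $v$ has its other endpoint in $X_v$. Twin-width: a partition sequence of an $n$-vertex graph $G$ is a sequence $\mathcal P_n, \dots, \mathcal P_1$ of partitions of $V(G)$ where $\mathcal P_n$ consists of singletons and each $\mathcal P_i$ ($i<n$) is obtained from $\mathcal P_{i+1}$ by merging two parts. For a partition $\mathcal P$, $\mathcal R(\mathcal P)$ is the graph on the parts with an edge between distinct parts $P, P'$ if there are $u,v\in P$ and $u',v' \in P'$ with $uu' \in E(G)$ and $vv' \notin E(G)$. The twin-width of $G$ is the least $d$ such that $G$ has a partition sequence with every $\mathcal R(\mathcal P_i)$ of maximum degree at most $d$. -}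

module Defs where

open import Data.Nat using (ℕ; zero; suc; _≤_; _<_)
open import Data.Fin as F using (Fin; toℕ)
open import Data.Fin.Properties using () renaming (_≟_ to _≟F_)
open import Data.Bool using (Bool; true; false)
open import Data.List using (List; length; filter; allFin)
open import Data.List.Relation.Unary.All using (All)
open import Data.List.Relation.Unary.Linked using (Linked)
open import Data.List.Relation.Unary.Unique.Propositional using (Unique)
open import Data.List.Membership.Propositional using (_∈_)
open import Data.Product using (Σ; _×_; _,_; proj₁; ∃-syntax)
open import Data.Sum using (_⊎_)
open import Relation.Nullary using (¬_)
open import Relation.Binary.PropositionalEquality using (_≡_; _≢_)
open import Function.Bundles using (_⇔_)

-- A partition of Fin k, given by a labelling: two vertices lie in the
-- same part iff they carry the same label.
Partition : ℕ → Set
Partition k = Fin k → ℕ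

Discrete : ∀ {k} → Partition k → Set
Discrete {k} c = ∀ (x y : Fin k) → c x ≡ c y → x ≡ y

MergeOf : ∀ {k} → Partition k → Partition k → Set
MergeOf {k} c′ c =
  ∃[ x ] ∃[ y ] (c′ x ≢ c′ y ×
    (∀ (u v : Fin k) →
       (c u ≡ c v) ⇔
       (c′ u ≡ c′ v ⊎
         ((c′ u ≡ c′ x ⊎ c′ u ≡ c′ y) × (c′ v ≡ c′ x ⊎ c′ v ≡ c′ y)))))

RedAdj : ∀ {k} → (Fin k → Fin k → Bool) → Partition k → ℕ → ℕ → Set
RedAdj {k} adj c a b =
  a ≢ b ×
  ∃[ u ] ∃[ v ] ∃[ u′ ] ∃[ v′ ]
    (c u ≡ a × c v ≡ a × c u′ ≡ b × c v′ ≡ b ×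
     adj u u′ ≡ true × adj v v′ ≡ false)

RedDegAtMost : ∀ {k} → (Fin k → Fin k → Bool) → Partition k → ℕ → Set
RedDegAtMost {k} adj c d =
  ∀ (x : Fin k) (L : List ℕ) → Unique L → All (RedAdj adj c (c x)) L →
    length L ≤ d

TwinWidthAtMost : (k : ℕ) → (Fin k → Fin k → Bool) → ℕ → Set
TwinWidthAtMost k adj d =
  Σ (ℕ → Partition k) λ P → (Discrete (P k) ×
          (∀ i → 1 ≤ i → i < k → MergeOf (P (suc i)) (P i)) ×
          (∀ i → 1 ≤ i → i ≤ k → RedDegAtMost adj (P i) d))

-- Countably infinite, locally finite, planarly embedded rooted trees,
-- given layer by layer: layer n has size ℓ n (finite, nonempty),
-- its nodes are Fin (ℓ n) ordered left to right, and par n sends a node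
-- of layer n+1 to its parent in layer n.  Planarity of the embedding is
-- exactly monotonicity of the parent maps.

record PlaneTree : Set where
  field
    ℓ        : ℕ → ℕ
    ℓ-root   : ℓ 0 ≡ 1
    ℓ-pos    : ∀ n → 1 ≤ ℓ n
    par      : ∀ n → Fin (ℓ (suc n)) → Fin (ℓ n)
    par-mono : ∀ n (i j : Fin (ℓ (suc n))) → i F.≤ j → par n i F.≤ par n j

module _ (T : PlaneTree) where
  open PlaneTree T

  Node : Set
  Node = Σ ℕ (λ n → Fin (ℓ n))

  layer : Node → ℕ
  layer = proj₁

  -- parent (the root is mapped to itself)
  up : Node → Node
  up (zero , i)  = (zero , i)
  up (suc n , i) = (n , par n i)

  iter : ℕ → Node → Node
  iter zero    v = v
  iter (suc k) v = up (iter k v)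

  -- u is an ancestor of v (every node is its own ancestor)
  Anc : Node → Node → Set
  Anc u v = ∃[ k ] iter k v ≡ u

  childCount : (n : ℕ) → Fin (ℓ n) → ℕ
  childCount n i = length (filter (λ j → par n j ≟F i) (allFin (ℓ (suc n))))

  degT : Node → ℕ
  degT (zero , i)  = childCount zero i
  degT (suc n , i) = suc (childCount (suc n) i)

  TAdj : Node → Node → Set
  TAdj u v = (layer u ≡ suc (layer v) × up u ≡ v)
           ⊎ (layer v ≡ suc (layer u) × up v ≡ u)

  TPath : List Node → Set
  TPath p = Unique p × Linked TAdj p

record LayeredWheel : Set where
  field
    tree : PlaneTree
  open PlaneTree tree
  field
    adj      : Node tree → Node tree → Bool
    adj-sym  : ∀ u v → adj u v ≡ adj v u
    adj-irr  : ∀ v → adj v v ≡ false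
    layer-path : ∀ n (i j : Fin (ℓ n)) →
      (adj (n , i) (n , j) ≡ true) ⇔
      (suc (toℕ i) ≡ toℕ j ⊎ suc (toℕ j) ≡ toℕ i)
    nonlayer-anc : ∀ u v → adj u v ≡ true → layer tree u ≢ layer tree v →
      Anc tree u v ⊎ Anc tree v u
    deg2-bounded : ∃[ B ] ∀ (p : List (Node tree)) → TPath tree p →
      All (λ v → degT tree v ≡ 2) p → length p ≤ B

module _ (W : LayeredWheel) where
  open LayeredWheel W
  open PlaneTree tree

  Neat : Set
  Neat = ∀ n (i : Fin (ℓ n)) → ∃[ j ] par n j ≡ i

  -- edges of G - E_L are the edges between different layers
  UpwardRestricted : Set
  UpwardRestricted =
    ∃[ t ] ∀ (v : Node tree) → ∃[ X ]
      (length X ≤ t × All (λ x → Anc tree x v) X ×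
       (∀ x y → adj x y ≡ true → layer tree x ≢ layer tree y →
          Anc tree v x → ¬ Anc tree v y → y ∈ X))

  FiniteInducedBoundedTww : Set
  FiniteInducedBoundedTww =
    ∃[ d ] ∀ (k : ℕ) (f : Fin k → Node tree) →
      (∀ a b → f a ≡ f b → a ≡ b) →
      TwinWidthAtMost k (λ a b → adj (f a) (f b)) d

{-# OPTIONS --safe #-}

-- Fix a finite set of vertices of W and contract the tree T from the bottom layer upwards,
-- one node at a time.  At stage (n, p) a vertex is represented by its frontier node (its
-- ancestor on layer n, or the parent of that ancestor if the latter lies left of position p),
-- and two chosen vertices have the same key if they have the same frontier node g, agree on
-- being g, and have the same neighbours among the chosen ancestors of g.  Passing one more
-- node merges key classes in groups of at most 8 (three bits tell them apart), so the stages
-- form a chain of coarsening equivalences from equality to a single class.  If two classes of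
-- a stage are joined by both an edge and a non-edge then, as every edge joins layer neighbours
-- or an ancestor to a descendant, the frontier node of one is among five nodes close to that
-- of the other (this uses that T has no leaves), and its key is fixed by these five bits, one
-- flag, and the adjacencies to its frontier node g and to the at most t exits X g that upward
-- restriction provides.  Finally, any chain of coarsening equivalences with such bounds yields
-- a partition sequence by merging parts one at a time: each intermediate partition lies
-- between two consecutive equivalences, which bounds its red degree.

module Submission where

open import Data.Bool using (Bool; true; false; _∧_; if_then_else_)
import Data.Bool.Properties as Bool
open import Data.Empty using (⊥-elim)
open import Data.Fin as Fin using (Fin; toℕ)
open import Data.Fin.Properties using (toℕ-injective; toℕ<n; toℕ-fromℕ<; any?)
open import Data.List using (List; []; _∷_; [_]; length; filter; map; _++_; allFin; replicate; take; drop)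
import Data.List.Properties as List
open import Data.List.Properties
  using (map-cong; ∷-injective; length-map; length-++; length-replicate; length-removeAt′; length-tabulate)
open import Data.List.Extrema.Nat using (max; xs≤max)
open import Data.List.Membership.Propositional using (_∈_)
open import Data.List.Membership.Propositional.Properties
  using (∈-map⁺; ∈-map⁻; ∈-++⁺ˡ; ∈-++⁺ʳ; ∈-filter⁻; ∈-filter⁺; ∈-allFin)
open import Data.List.Relation.Binary.Pointwise using ([]; _∷_; ≡⇒Pointwise-≡)
open import Data.List.Relation.Binary.Subset.Propositional using (_⊆_)
import Data.List.Relation.Binary.Sublist.Propositional.Properties as Sublist
open import Data.List.Relation.Unary.All as All using (All; []; _∷_)
open import Data.List.Relation.Unary.All.Properties using (all-filter)
open import Data.List.Relation.Unary.AllPairs as AllPairs using (AllPairs; []; _∷_)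
import Data.List.Relation.Unary.AllPairs.Properties as AllPairs
open import Data.List.Relation.Unary.Any using (here; there; index; _─_)
open import Data.List.Relation.Unary.Unique.Propositional using (Unique)
import Data.List.Relation.Unary.Unique.Propositional.Properties as Unique
open import Data.Nat as ℕ
  using (ℕ; zero; suc; pred; _+_; _*_; _∸_; _^_; _≤_; _<_; z≤n; s≤s; s≤s⁻¹; _≤?_; _<?_;
         _≤′_; ≤′-refl; ≤′-step)
open import Data.Nat.GeneralisedArithmetic using (fold; iterate; iterate-is-fold)
open import Data.Nat.Properties
import Data.Product as Prod
open import Data.Product using (Σ; ∃-syntax; _×_; _,_; proj₁; proj₂)
open import Data.Product.Properties using (≡-dec)
open import Data.Sum as Sum using (_⊎_; inj₁; inj₂)
open import Data.Unit using (⊤; tt)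
open import Function using (_∘_; id; _⇔_; mk⇔; Equivalence)
import Relation.Binary.Construct.On as On
open import Relation.Binary.Definitions using (DecidableEquality)
import Relation.Binary.PropositionalEquality as ≡
open import Relation.Binary.PropositionalEquality
  using (_≡_; _≢_; refl; sym; trans; cong; cong₂; subst; subst₂; module ≡-Reasoning)
open import Relation.Binary.Structures using (IsDecEquivalence)
open import Relation.Nullary using (¬_; ¬?; Dec; yes; no; does; contradiction; _×-dec_)
open import Relation.Nullary.Decidable using (dec-false)
import Relation.Unary as U
open import Relation.Unary.Properties using (∁?)

open import Defs

does-transfer : ∀ {A B : Set} (a? : Dec A) (b? : Dec B) → does a? ≡ does b? → A → B
does-transfer _       (yes b) _  _ = b
does-transfer (yes _) (no _)  () _
does-transfer (no ¬a) (no _)  _  a = contradiction a ¬a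

n<m⇒m∸n≡1+[m∸1+n] : ∀ {m n} → n < m → m ∸ n ≡ suc (m ∸ suc n)
n<m⇒m∸n≡1+[m∸1+n] {suc m} {zero}  _         = refl
n<m⇒m∸n≡1+[m∸1+n] {suc m} {suc n} (s≤s n<m) = n<m⇒m∸n≡1+[m∸1+n] n<m

map-≡⇒≡ : ∀ {A B : Set} {g₁ g₂ : A → B} {xs} →
  map g₁ xs ≡ map g₂ xs → ∀ {x} → x ∈ xs → g₁ x ≡ g₂ x
map-≡⇒≡ {xs = _ ∷ _} eq (here refl)  = proj₁ (∷-injective eq)
map-≡⇒≡ {xs = _ ∷ _} eq (there x∈xs) = map-≡⇒≡ (proj₂ (∷-injective eq)) x∈xs

-- Counting

module _ {A : Set} where

  ∈-─ : ∀ {x y : A} {xs} (x∈xs : x ∈ xs) → y ∈ xs → y ≢ x → y ∈ (xs ─ x∈xs)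
  ∈-─ (here refl)  (here refl)  y≢x = ⊥-elim (y≢x refl)
  ∈-─ (here _)     (there y∈xs) _   = y∈xs
  ∈-─ (there _)    (here y≡z)   _   = here y≡z
  ∈-─ (there x∈xs) (there y∈xs) y≢x = there (∈-─ x∈xs y∈xs y≢x)

  length-mono-⊆ : ∀ {xs ys : List A} → Unique xs → xs ⊆ ys → length xs ≤ length ys
  length-mono-⊆ {[]}     _              _       = z≤n
  length-mono-⊆ {x ∷ xs} {ys} (x∉xs ∷ xs!) x∷xs⊆ys = begin
    suc (length xs)           ≤⟨ s≤s (length-mono-⊆ xs! xs⊆ys─x) ⟩
    suc (length (ys ─ x∈ys))  ≡⟨ sym (length-removeAt′ ys (index x∈ys)) ⟩
    length ys                 ∎
    where
    open ≤-Reasoning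
    x∈ys = x∷xs⊆ys (here refl)
    xs⊆ys─x : xs ⊆ (ys ─ x∈ys)
    xs⊆ys─x y∈xs = ∈-─ x∈ys (x∷xs⊆ys (there y∈xs)) (λ y≡x → All.lookup x∉xs y∈xs (sym y≡x))

bitStrings : ℕ → List (List Bool)
bitStrings zero    = [ [] ]
bitStrings (suc m) = map (true ∷_) (bitStrings m) ++ map (false ∷_) (bitStrings m)

length-bitStrings : ∀ m → length (bitStrings m) ≡ 2 ^ m
length-bitStrings zero    = refl
length-bitStrings (suc m) = begin
  length (map (true ∷_) bs ++ map (false ∷_) bs)          ≡⟨ length-++ (map (true ∷_) bs) ⟩
  length (map (true ∷_) bs) + length (map (false ∷_) bs)  ≡⟨ cong₂ _+_ (length-map _ bs) (length-map _ bs) ⟩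
  length bs + length bs                                   ≡⟨ cong₂ _+_ (length-bitStrings m) (length-bitStrings m) ⟩
  2 ^ m + 2 ^ m                                           ≡⟨ cong (2 ^ m +_) (sym (+-identityʳ (2 ^ m))) ⟩
  2 ^ suc m                                               ∎
  where
  open ≡-Reasoning
  bs = bitStrings m

∈-bitStrings : ∀ bs → bs ∈ bitStrings (length bs)
∈-bitStrings []           = here refl
∈-bitStrings (true ∷ bs)  = ∈-++⁺ˡ (∈-map⁺ (true ∷_) (∈-bitStrings bs))
∈-bitStrings (false ∷ bs) = ∈-++⁺ʳ (map (true ∷_) _) (∈-map⁺ (false ∷_) (∈-bitStrings bs))

length≤2^-of-code : ∀ {A : Set} {Q : A → Set} {R : A → A → Set} (κ : A → List Bool) {m} →
  (∀ a → length (κ a) ≡ m) → (∀ {a b} → Q a → Q b → κ a ≡ κ b → R a b) →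
  ∀ {L} → All Q L → AllPairs (λ a b → ¬ R a b) L → length L ≤ 2 ^ m
length≤2^-of-code {Q = Q} {R = R} κ {m} κ-length κ-separates {L} QL ≁L = begin
  length L               ≡⟨ sym (length-map κ L) ⟩
  length (map κ L)       ≤⟨ length-mono-⊆ (AllPairs.map⁺ (codes-distinct QL ≁L)) κL⊆bitStrings ⟩
  length (bitStrings m)  ≡⟨ length-bitStrings m ⟩
  2 ^ m                  ∎
  where
  open ≤-Reasoning
  codes-distinct : ∀ {L} → All Q L → AllPairs (λ a b → ¬ R a b) L → AllPairs (λ a b → κ a ≢ κ b) L
  codes-distinct []        []           = []
  codes-distinct (Qa ∷ QL) (a≁L ∷ ≁L) =
    All.zipWith (λ (Qb , a≁b) → a≁b ∘ κ-separates Qa Qb) (QL , a≁L) ∷ codes-distinct QL ≁L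
  κL⊆bitStrings : map κ L ⊆ bitStrings m
  κL⊆bitStrings bs∈κL with _ , _ , refl ← ∈-map⁻ κ bs∈κL =
    subst (λ j → _ ∈ bitStrings j) (κ-length _) (∈-bitStrings _)

module _ {A : Set} {P : A → Set} (P? : U.Decidable P) where

  length-filter+∁ : ∀ L → length (filter P? L) + length (filter (∁? P?) L) ≡ length L
  length-filter+∁ []      = refl
  length-filter+∁ (x ∷ L) with P? x
  ... | yes _ = cong suc (length-filter+∁ L)
  ... | no  _ = trans (+-suc _ _) (cong suc (length-filter+∁ L))

module _ {A : Set} {E : A → A → Set} (E? : ∀ x y → Dec (E x y)) where

  length≤#classes*classSize : ∀ D M (L : List A) →
    (∀ y → length (filter (E? y) L) ≤ M) →
    (∀ R → AllPairs (λ a b → ¬ E a b) R → R ⊆ L → length R ≤ D) →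
    length L ≤ D * M
  length≤#classes*classSize D       M []        _ _ = z≤n
  length≤#classes*classSize zero    M (y ∷ L)   _ #classes =
    contradiction (#classes [ y ] ([] ∷ []) λ { (here refl) → here refl }) λ ()
  length≤#classes*classSize (suc D) M L@(y ∷ _) classSize #classes = begin
    length L                                ≡⟨ sym (length-filter+∁ (E? y) L) ⟩
    length (filter (E? y) L) + length rest  ≤⟨ +-mono-≤ (classSize y) (length≤#classes*classSize D M rest
                                                                         restClassSize rest#classes) ⟩
    M + D * M                               ∎
    where
    open ≤-Reasoning
    rest = filter (∁? (E? y)) L
    restClassSize : ∀ z → length (filter (E? z) rest) ≤ M
    restClassSize z = ≤-trans
      (Sublist.length-mono-≤ (Sublist.filter⁺ (E? z) (E? z) (λ { refl → id }) (Sublist.filter-⊆ (∁? (E? y)) L)))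
      (classSize z)
    -- y is inequivalent to everything in rest, so it extends any transversal of rest
    rest#classes : ∀ R → AllPairs (λ a b → ¬ E a b) R → R ⊆ rest → length R ≤ D
    rest#classes R ≁R R⊆rest = s≤s⁻¹ (#classes (y ∷ R)
      (All.tabulate (proj₂ ∘ ∈-filter⁻ (∁? (E? y)) ∘ R⊆rest) ∷ ≁R)
      λ { (here refl) → here refl ; (there r∈R) → proj₁ (∈-filter⁻ (∁? (E? y)) (R⊆rest r∈R)) })

-- Partition sequences from refining chains of equivalences

RedPair : {A : Set} → (A → A → Bool) → (A → A → Set) → A → A → Set
RedPair adj E x y = ¬ E x y × ∃[ u ] ∃[ v ] ∃[ u′ ] ∃[ v′ ]
  (E x u × E x v × E y u′ × E y v′ × adj u u′ ≡ true × adj v v′ ≡ false)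

RedPair-mono : ∀ {A : Set} {adj : A → A → Bool} {E E′ : A → A → Set} {x y} →
  (∀ {a b} → E a b → E′ a b) → ¬ E′ x y → RedPair adj E x y → RedPair adj E′ x y
RedPair-mono E⊆E′ ¬E′xy (_ , u , v , u′ , v′ , xu , xv , yu′ , yv′ , uu′ , vv′) =
  ¬E′xy , u , v , u′ , v′ , E⊆E′ xu , E⊆E′ xv , E⊆E′ yu′ , E⊆E′ yv′ , uu′ , vv′

NonConstant : ∀ {A B : Set} → (A → B) → Set
NonConstant c = ∃[ x ] ∃[ y ] c x ≢ c y

module _ {k : ℕ} {adj : Fin k → Fin k → Bool} (c : Fin k → Fin k) (x : Fin k) where

  redParts-representatives : ∀ {L} → All (RedAdj adj (toℕ ∘ c) (toℕ (c x))) L →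
    Σ (List (Fin k)) λ ys → map (toℕ ∘ c) ys ≡ L × All (RedPair adj (λ a b → c a ≡ c b) x) ys
  redParts-representatives [] = [] , refl , []
  redParts-representatives ((cx≢ , u , v , u′ , v′ , cu , cv , cu′ , cv′ , uu′ , vv′) ∷ reds)
    with ys , refl , redYs ← redParts-representatives reds =
    u′ ∷ ys , cong (_∷ _) cu′ ,
    ((λ cx≡cu′ → cx≢ (trans (cong toℕ cx≡cu′) cu′)) , u , v , u′ , v′ ,
      toℕ-injective (sym cu) , toℕ-injective (sym cv) , refl , toℕ-injective (trans cu′ (sym cv′)) ,
      uu′ , vv′) ∷ redYs

module _ {k : ℕ} (c : Fin k → Fin k) (a b : Fin k) where

  collapse : Fin k → Fin k
  collapse r = if does (r Fin.≟ c b) then c a else r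

  merge : Fin k → Fin k
  merge = collapse ∘ c

  collapse-outside : ∀ {r} → r ≢ c b → collapse r ≡ r
  collapse-outside {r} r≢cb with r Fin.≟ c b
  ... | yes r≡cb = contradiction r≡cb r≢cb
  ... | no  _    = refl

  InPair : Fin k → Set
  InPair x = c x ≡ c a ⊎ c x ≡ c b

  merge-inPair : ∀ {x} → InPair x → merge x ≡ c a
  merge-inPair {x} x∈ab with c x Fin.≟ c b | x∈ab
  ... | yes _    | _          = refl
  ... | no _     | inj₁ cx≡ca = cx≡ca
  ... | no cx≢cb | inj₂ cx≡cb = contradiction cx≡cb cx≢cb

  merge-≡⇔ : ∀ x y → (merge x ≡ merge y) ⇔ (c x ≡ c y ⊎ (InPair x × InPair y))
  merge-≡⇔ x y = mk⇔ to from
    where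
    to : merge x ≡ merge y → c x ≡ c y ⊎ (InPair x × InPair y)
    to eq with c x Fin.≟ c b | c y Fin.≟ c b
    ... | yes cx≡cb | yes cy≡cb = inj₁ (trans cx≡cb (sym cy≡cb))
    ... | yes cx≡cb | no  _     = inj₂ (inj₂ cx≡cb , inj₁ (sym eq))
    ... | no  _     | yes cy≡cb = inj₂ (inj₁ eq , inj₂ cy≡cb)
    ... | no  _     | no  _     = inj₁ eq
    from : c x ≡ c y ⊎ (InPair x × InPair y) → merge x ≡ merge y
    from (inj₁ cx≡cy)         = cong collapse cx≡cy
    from (inj₂ (x∈ab , y∈ab)) = trans (merge-inPair x∈ab) (sym (merge-inPair y∈ab))

  merge-idem : (∀ x → c (c x) ≡ c x) → c a ≢ c b → ∀ x → merge (merge x) ≡ merge x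
  merge-idem idem ca≢cb x with c x Fin.≟ c b
  ... | yes _    = trans (cong collapse (idem a)) (collapse-outside ca≢cb)
  ... | no cx≢cb = trans (cong collapse (idem x)) (collapse-outside cx≢cb)

  merge-mergeOf : c a ≢ c b → MergeOf (toℕ ∘ c) (toℕ ∘ merge)
  merge-mergeOf ca≢cb = a , b , ca≢cb ∘ toℕ-injective , λ u v → mk⇔
    (Sum.map (cong toℕ) (Prod.map inPairℕ inPairℕ) ∘ Equivalence.to (merge-≡⇔ u v) ∘ toℕ-injective)
    (cong toℕ ∘ Equivalence.from (merge-≡⇔ u v) ∘ Sum.map toℕ-injective (Prod.map inPairFin inPairFin))
    where
    inPairℕ : ∀ {x} → InPair x → toℕ (c x) ≡ toℕ (c a) ⊎ toℕ (c x) ≡ toℕ (c b)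
    inPairℕ = Sum.map (cong toℕ) (cong toℕ)
    inPairFin : ∀ {x} → toℕ (c x) ≡ toℕ (c a) ⊎ toℕ (c x) ≡ toℕ (c b) → InPair x
    inPairFin = Sum.map toℕ-injective toℕ-injective

module _ {k : ℕ} where

  fixedPoints : (Fin k → Fin k) → List (Fin k)
  fixedPoints c = filter (λ r → c r Fin.≟ r) (allFin k)

  fixedPoints-unique : ∀ c → Unique (fixedPoints c)
  fixedPoints-unique c = Unique.filter⁺ (λ r → c r Fin.≟ r) (Unique.allFin⁺ k)

  ∈-fixedPoints : ∀ {c r} → c r ≡ r → r ∈ fixedPoints c
  ∈-fixedPoints {c} {r} = ∈-filter⁺ (λ r → c r Fin.≟ r) (∈-allFin r)

  fixedPoints-fixed : ∀ {c r} → r ∈ fixedPoints c → c r ≡ r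
  fixedPoints-fixed {c} = proj₂ ∘ ∈-filter⁻ (λ r → c r Fin.≟ r) {xs = allFin k}

  k≤#fixedPoints-id : k ≤ length (fixedPoints id)
  k≤#fixedPoints-id = subst (_≤ length (fixedPoints id)) (length-tabulate id)
    (length-mono-⊆ (Unique.allFin⁺ k) (λ _ → ∈-fixedPoints refl))

  #fixedPoints-merge : ∀ c a b → length (fixedPoints c) ≤ suc (length (fixedPoints (merge c a b)))
  #fixedPoints-merge c a b = length-mono-⊆ (fixedPoints-unique c) Fix[c]⊆
    where
    Fix[c]⊆ : fixedPoints c ⊆ c b ∷ fixedPoints (merge c a b)
    Fix[c]⊆ {r} r∈Fix with r Fin.≟ c b
    ... | yes r≡cb = here r≡cb
    ... | no  r≢cb = there (∈-fixedPoints {merge c a b}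
                      (trans (cong (collapse c a b) (fixedPoints-fixed r∈Fix)) (collapse-outside c a b r≢cb)))

  2≤#fixedPoints⇒nonConstant : ∀ {c} → 2 ≤ length (fixedPoints c) → NonConstant c
  2≤#fixedPoints⇒nonConstant {c} = two (fixedPoints c) (fixedPoints-unique c) fixedPoints-fixed
    where
    two : ∀ rs → Unique rs → (∀ {r} → r ∈ rs → c r ≡ r) → 2 ≤ length rs → NonConstant c
    two (_ ∷ [])     _                 _     (s≤s ())
    two (r ∷ r′ ∷ _) ((r≢r′ ∷ _) ∷ _) fixed _ =
      r , r′ , λ cr≡cr′ → r≢r′ (trans (sym (fixed (here refl))) (trans cr≡cr′ (fixed (there (here refl)))))

record RefiningChain (k : ℕ) (adj : Fin k → Fin k → Bool) (M D : ℕ) : Set₁ where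
  field
    E                : ℕ → Fin k → Fin k → Set
    isDecEquivalence : ∀ s → IsDecEquivalence (E s)
    E₀⇒≡             : ∀ {x y} → E 0 x y → x ≡ y
    E-step           : ∀ s {x y} → E s x y → E (suc s) x y
    height           : ℕ
    E-height         : ∀ x y → E height x y
    split-bound      : ∀ s x L → AllPairs (λ a b → ¬ E s a b) L → All (E (suc s) x) L → length L ≤ M
    red-bound        : ∀ s x L → AllPairs (λ a b → ¬ E s a b) L →
                       All (RedPair adj (E s) x) L → length L ≤ D

module _ {k : ℕ} {adj : Fin k → Fin k → Bool} {M D : ℕ} (C : RefiningChain k adj M D) where
  open RefiningChain C

  private
    E? : ∀ s x y → Dec (E s x y)
    E? s = IsDecEquivalence._≟_ (isDecEquivalence s)

    E-sym : ∀ s {x y} → E s x y → E s y x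
    E-sym s = IsDecEquivalence.sym (isDecEquivalence s)

    E-trans : ∀ s {x y z} → E s x y → E s y z → E s x z
    E-trans s = IsDecEquivalence.trans (isDecEquivalence s)

  E-above-height : ∀ {s} → height ≤ s → ∀ x y → E s x y
  E-above-height h≤s x y = go (≤⇒≤′ h≤s)
    where
    go : ∀ {s} → height ≤′ s → E s x y
    go ≤′-refl        = E-height x y
    go (≤′-step h≤′s) = E-step _ (go h≤′s)

  Sandwiched : ℕ → (Fin k → Fin k) → Set
  Sandwiched s c = (∀ {x y} → E s x y → c x ≡ c y) × (∀ {x y} → c x ≡ c y → E (suc s) x y)

  -- A part of c is red only to parts in its own E (s + 1)-class (at most M of them) and to
  -- parts inside the at most D E (s + 1)-classes red to its own (at most M in each).
  sandwiched⇒redDeg≤ : ∀ {s c} → Sandwiched s c → RedDegAtMost adj (toℕ ∘ c) (M + D * M)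
  sandwiched⇒redDeg≤ {s} {c} (E⊆c , c⊆E′) x L L! redL
    with ys , refl , redYs ← redParts-representatives c x redL = begin
    length (map (toℕ ∘ c) ys)                          ≡⟨ length-map (toℕ ∘ c) ys ⟩
    length ys                                          ≡⟨ sym (length-filter+∁ (E? (suc s) x) ys) ⟩
    length (filter (E? (suc s) x) ys) + length others
      ≤⟨ +-mono-≤ (split-bound s x _ (AllPairs.filter⁺ _ ≁ys) (all-filter _ ys))
                  (length≤#classes*classSize (E? (suc s)) D M others classSize #classes) ⟩
    M + D * M                                          ∎
    where
    open ≤-Reasoning
    ≁ys : AllPairs (λ a b → ¬ E s a b) ys
    ≁ys = AllPairs.map (λ ca≢cb → ca≢cb ∘ cong toℕ ∘ E⊆c) (AllPairs.map⁻ L!)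
    others = filter (∁? (E? (suc s) x)) ys
    classSize : ∀ z → length (filter (E? (suc s) z) others) ≤ M
    classSize z = split-bound s z _ (AllPairs.filter⁺ _ (AllPairs.filter⁺ _ ≁ys)) (all-filter _ others)
    #classes : ∀ R → AllPairs (λ a b → ¬ E (suc s) a b) R → R ⊆ others → length R ≤ D
    #classes R ≁R R⊆others = red-bound (suc s) x R ≁R (All.tabulate λ r∈R →
      let r∈ys , x≁r = ∈-filter⁻ (∁? (E? (suc s) x)) (R⊆others r∈R)
      in RedPair-mono (λ {a b} → c⊆E′ {a} {b}) x≁r (All.lookup redYs r∈ys))

  Mergeable : ℕ → (Fin k → Fin k) → Set
  Mergeable s c = ∃[ a ] ∃[ b ] (c a ≢ c b × E (suc s) a b)

  MergeStep : (Fin k → Fin k) → Set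
  MergeStep c = ∃[ s ] (Sandwiched s c × Mergeable s c)

  findMergeStep : ∀ fuel {s c} → height ≤ fuel + s → Sandwiched s c → NonConstant c → MergeStep c
  findMergeStep zero {s} h≤s sw (x , y , cx≢cy) =
    s , sw , x , y , cx≢cy , E-above-height (≤-trans h≤s (n≤1+n s)) x y
  findMergeStep (suc fuel) {s} {c} h≤ sw@(E⊆c , c⊆E′) nonConst
    with any? (λ a → any? (λ b → ¬? (c a Fin.≟ c b) ×-dec E? (suc s) a b))
  ... | yes mergeable = s , sw , mergeable
  ... | no ¬mergeable =
    findMergeStep fuel (subst (height ≤_) (sym (+-suc fuel s)) h≤) (E′⊆c , E-step (suc s) ∘ c⊆E′) nonConst
    where
    E′⊆c : ∀ {x y} → E (suc s) x y → c x ≡ c y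
    E′⊆c {x} {y} e with c x Fin.≟ c y
    ... | yes cx≡cy = cx≡cy
    ... | no  cx≢cy = contradiction (x , y , cx≢cy , e) ¬mergeable

  -- a partition given by an idempotent choice of representatives; its parts are the fixed points
  record SandwichedPartition : Set where
    field
      rep        : Fin k → Fin k
      rep-idem   : ∀ x → rep (rep x) ≡ rep x
      level      : ℕ
      sandwiched : Sandwiched level rep

  open SandwichedPartition

  labels : SandwichedPartition → Partition k
  labels σ = toℕ ∘ rep σ

  #parts : SandwichedPartition → ℕ
  #parts σ = length (fixedPoints (rep σ))

  discrete : SandwichedPartition
  discrete = record
    { rep        = id
    ; rep-idem   = λ _ → refl
    ; level      = 0
    ; sandwiched = E₀⇒≡ , λ { refl → IsDecEquivalence.refl (isDecEquivalence 1) }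
    }

  mergeAlong : (σ : SandwichedPartition) → MergeStep (rep σ) → SandwichedPartition
  mergeAlong σ (s , (E⊆c , c⊆E′) , a , b , ca≢cb , Eab) = record
    { rep        = merge (rep σ) a b
    ; rep-idem   = merge-idem (rep σ) a b (rep-idem σ) ca≢cb
    ; level      = s
    ; sandwiched = cong (collapse (rep σ) a b) ∘ E⊆c , λ {x} {y} eq →
        Sum.[ c⊆E′ , (λ (x∈ab , y∈ab) → E-trans (suc s) (toA x∈ab) (E-sym (suc s) (toA y∈ab))) ]
          (Equivalence.to (merge-≡⇔ (rep σ) a b x y) eq)
    }
    where
    toA : ∀ {x} → InPair (rep σ) a b x → E (suc s) x a
    toA (inj₁ cx≡ca) = c⊆E′ cx≡ca
    toA (inj₂ cx≡cb) = E-trans (suc s) (c⊆E′ cx≡cb) (E-sym (suc s) Eab)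

  mergeAlong-mergeOf : ∀ σ m → MergeOf (labels σ) (labels (mergeAlong σ m))
  mergeAlong-mergeOf σ (_ , _ , a , b , ca≢cb , _) = merge-mergeOf (rep σ) a b ca≢cb

  #parts-mergeAlong : ∀ σ m → #parts σ ≤ suc (#parts (mergeAlong σ m))
  #parts-mergeAlong σ (_ , _ , a , b , _) = #fixedPoints-merge (rep σ) a b

  nonConstant? : (c : Fin k → Fin k) → Dec (NonConstant c)
  nonConstant? c = any? (λ x → any? (λ y → ¬? (c x Fin.≟ c y)))

  mergeStep : ∀ σ → NonConstant (rep σ) → MergeStep (rep σ)
  mergeStep σ = findMergeStep height (m≤m+n height (level σ)) (sandwiched σ)

  coarsen : SandwichedPartition → SandwichedPartition
  coarsen σ with nonConstant? (rep σ)
  ... | yes nonConst = mergeAlong σ (mergeStep σ nonConst)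
  ... | no  _        = σ

  #parts-coarsen : ∀ σ → #parts σ ≤ suc (#parts (coarsen σ))
  #parts-coarsen σ with nonConstant? (rep σ)
  ... | yes nonConst = #parts-mergeAlong σ (mergeStep σ nonConst)
  ... | no  _        = n≤1+n (#parts σ)

  coarsen-mergeOf : ∀ σ → 2 ≤ #parts σ → MergeOf (labels σ) (labels (coarsen σ))
  coarsen-mergeOf σ 2≤#parts with nonConstant? (rep σ)
  ... | yes nonConst = mergeAlong-mergeOf σ (mergeStep σ nonConst)
  ... | no  constant = contradiction (2≤#fixedPoints⇒nonConstant 2≤#parts) constant

  coarsenings : ℕ → SandwichedPartition
  coarsenings zero    = discrete
  coarsenings (suc m) = coarsen (coarsenings m)

  k≤m+#parts : ∀ m → k ≤ m + #parts (coarsenings m)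
  k≤m+#parts zero    = k≤#fixedPoints-id
  k≤m+#parts (suc m) = begin
    k                             ≤⟨ k≤m+#parts m ⟩
    m + #parts σ                  ≤⟨ +-monoʳ-≤ m (#parts-coarsen σ) ⟩
    m + suc (#parts (coarsen σ))  ≡⟨ +-suc m _ ⟩
    suc m + #parts (coarsen σ)    ∎
    where
    open ≤-Reasoning
    σ = coarsenings m

  refiningChain⇒twinWidth≤ : TwinWidthAtMost k adj (M + D * M)
  refiningChain⇒twinWidth≤ =
    P , P-discrete , P-merges , λ i _ _ → sandwiched⇒redDeg≤ (sandwiched (coarsenings (k ∸ i)))
    where
    P : ℕ → Partition k
    P i = labels (coarsenings (k ∸ i))
    P-discrete : Discrete (P k)
    P-discrete x y rewrite n∸n≡0 k = toℕ-injective
    P-merges : ∀ i → 1 ≤ i → i < k → MergeOf (P (suc i)) (P i)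
    P-merges i 1≤i i<k rewrite n<m⇒m∸n≡1+[m∸1+n] i<k = coarsen-mergeOf σ (begin
      2                ≤⟨ s≤s 1≤i ⟩
      suc i            ≡⟨ sym (m∸[m∸n]≡n i<k) ⟩
      k ∸ (k ∸ suc i)  ≤⟨ m≤n+o⇒m∸n≤o k (k ∸ suc i) (k≤m+#parts (k ∸ suc i)) ⟩
      #parts σ         ∎)
      where
      open ≤-Reasoning
      σ = coarsenings (k ∸ suc i)

-- Ancestors and neighbours in plane trees

module Ancestry (T : PlaneTree) where
  open PlaneTree T

  lay : Node T → ℕ
  lay = layer T

  pos : Node T → ℕ
  pos = toℕ ∘ proj₂

  parent : Node T → Node T
  parent = up T

  infix 4 _≼_
  _≼_ : Node T → Node T → Set
  _≼_ = Anc T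

  node-≡ : ∀ {x y : Node T} → lay x ≡ lay y → pos x ≡ pos y → x ≡ y
  node-≡ {m , i} {.m , j} refl i≡j = cong (m ,_) (toℕ-injective i≡j)

  _≟ₙ_ : DecidableEquality (Node T)
  _≟ₙ_ = ≡-dec ℕ._≟_ Fin._≟_

  pos<ℓ : ∀ x → pos x < ℓ (lay x)
  pos<ℓ (_ , i) = toℕ<n i

  lay-parent : ∀ x → lay (parent x) ≡ pred (lay x)
  lay-parent (zero  , _) = refl
  lay-parent (suc _ , _) = refl

  lay-iter : ∀ j x → lay (iter T j x) ≡ lay x ∸ j
  lay-iter zero    x = refl
  lay-iter (suc j) x = begin
    lay (parent (iter T j x))  ≡⟨ lay-parent (iter T j x) ⟩
    pred (lay (iter T j x))    ≡⟨ cong pred (lay-iter j x) ⟩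
    pred (lay x ∸ j)           ≡⟨ pred[m∸n]≡m∸[1+n] (lay x) j ⟩
    lay x ∸ suc j              ∎
    where open ≡-Reasoning

  iter-+ : ∀ i j x → iter T (i + j) x ≡ iter T i (iter T j x)
  iter-+ zero    j x = refl
  iter-+ (suc i) j x = cong parent (iter-+ i j x)

  iter-root : ∀ j {x} → lay x ≡ 0 → iter T j x ≡ x
  iter-root zero    _ = refl
  iter-root (suc j) {zero , i} refl = cong parent (iter-root j {zero , i} refl)

  iter-beyond : ∀ {j} x → lay x ≤ j → iter T j x ≡ iter T (lay x) x
  iter-beyond {j} x lay≤j = begin
    iter T j x                             ≡⟨ cong (λ i → iter T i x) (sym (m∸n+n≡m lay≤j)) ⟩
    iter T ((j ∸ lay x) + lay x) x         ≡⟨ iter-+ (j ∸ lay x) (lay x) x ⟩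
    iter T (j ∸ lay x) (iter T (lay x) x)  ≡⟨ iter-root (j ∸ lay x) lay≡0 ⟩
    iter T (lay x) x                       ∎
    where
    open ≡-Reasoning
    lay≡0 = trans (lay-iter (lay x) x) (n∸n≡0 (lay x))

  -- the ancestor of x on layer n; x itself when n ≥ lay x
  anc : ℕ → Node T → Node T
  anc n x = iter T (lay x ∸ n) x

  lay-anc : ∀ {n} x → n ≤ lay x → lay (anc n x) ≡ n
  lay-anc {n} x n≤lay = trans (lay-iter (lay x ∸ n) x) (m∸[m∸n]≡n n≤lay)

  anc-self : ∀ {n} z → lay z ≡ n → anc n z ≡ z
  anc-self z refl = cong (λ j → iter T j z) (n∸n≡0 (lay z))

  anc-≼ : ∀ n x → anc n x ≼ x
  anc-≼ n x = lay x ∸ n , refl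

  ≼-refl : ∀ {x} → x ≼ x
  ≼-refl = 0 , refl

  ≼-trans : ∀ {a b c} → a ≼ b → b ≼ c → a ≼ c
  ≼-trans {c = c} (i , refl) (j , refl) = i + j , iter-+ i j c

  parent-≼ : ∀ x → parent x ≼ x
  parent-≼ x = 1 , refl

  ≼⇒lay≤ : ∀ {u v} → u ≼ v → lay u ≤ lay v
  ≼⇒lay≤ {v = v} (j , refl) = subst (_≤ lay v) (sym (lay-iter j v)) (m∸n≤m (lay v) j)

  ≼⇒anc≡ : ∀ {u v} → u ≼ v → anc (lay u) v ≡ u
  ≼⇒anc≡ {v = v} (j , refl) with j ≤? lay v
  ... | yes j≤lay = trans (cong (λ i → iter T (lay v ∸ i) v) (lay-iter j v))
                          (cong (λ i → iter T i v) (m∸[m∸n]≡n j≤lay))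
  ... | no  j≰lay = trans (cong (λ i → iter T (lay v ∸ i) v) (trans (lay-iter j v) (m≤n⇒m∸n≡0 lay≤j)))
                         (sym (iter-beyond v lay≤j))
    where lay≤j = ≰⇒≥ j≰lay

  _≼?_ : ∀ u v → Dec (u ≼ v)
  u ≼? v with anc (lay u) v ≟ₙ u
  ... | yes anc≡u = yes (lay v ∸ lay u , anc≡u)
  ... | no  anc≢u = no (anc≢u ∘ ≼⇒anc≡)

  ≼-unique : ∀ {a b x} → a ≼ x → b ≼ x → lay a ≡ lay b → a ≡ b
  ≼-unique {x = x} a≼x b≼x lay≡ =
    trans (sym (≼⇒anc≡ a≼x)) (trans (cong (λ n → anc n x) lay≡) (≼⇒anc≡ b≼x))

  ≼∧lay≡⇒≡ : ∀ {u v} → u ≼ v → lay u ≡ lay v → u ≡ v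
  ≼∧lay≡⇒≡ u≼v = ≼-unique u≼v ≼-refl

  ≼-between : ∀ {a b h} → a ≼ b → h ≼ b → lay a ≤ lay h → a ≼ h
  ≼-between {a} {b} {h} a≼b h≼b lay≤ =
    subst (_≼ h) (≼-unique (≼-trans (anc-≼ (lay a) h) h≼b) a≼b (lay-anc h lay≤)) (anc-≼ (lay a) h)

  anc-of-≼ : ∀ {a b} n → a ≼ b → n ≤ lay a → anc n b ≡ anc n a
  anc-of-≼ {a} {b} n a≼b n≤lay =
    ≼-unique (anc-≼ n b) (≼-trans (anc-≼ n a) a≼b)
      (trans (lay-anc b (≤-trans n≤lay (≼⇒lay≤ a≼b))) (sym (lay-anc a n≤lay)))

  parent-anc : ∀ {n} x → suc n ≤ lay x → parent (anc (suc n) x) ≡ anc n x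
  parent-anc {n} x n<lay =
    ≼-unique (≼-trans (parent-≼ _) (anc-≼ (suc n) x)) (anc-≼ n x)
      (trans (lay-parent (anc (suc n) x))
             (trans (cong pred (lay-anc x n<lay)) (sym (lay-anc x (<⇒≤ n<lay)))))

  lay-parent-anc : ∀ {n} z → n ≤ lay z → lay (parent (anc n z)) ≡ pred n
  lay-parent-anc {n} z n≤ = trans (lay-parent (anc n z)) (cong pred (lay-anc z n≤))

  ≼-parent : ∀ {u w} → u ≼ w → u ≡ w ⊎ u ≼ parent w
  ≼-parent (zero  , refl)      = inj₁ refl
  ≼-parent {w = w} (suc j , refl) =
    inj₂ (j , trans (sym (iter-+ j 1 w)) (cong (λ i → iter T i w) (+-comm j 1)))

  lay≡0⇒≡ : ∀ {a b} → lay a ≡ 0 → lay b ≡ 0 → a ≡ b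
  lay≡0⇒≡ {zero , i} {zero , j} refl refl = node-≡ refl (trans (pos≡0 i) (sym (pos≡0 j)))
    where
    pos≡0 : ∀ (i : Fin (ℓ 0)) → toℕ i ≡ 0
    pos≡0 i = n≤0⇒n≡0 (s≤s⁻¹ (subst (toℕ i <_) ℓ-root (toℕ<n i)))

Leafless : PlaneTree → Set
Leafless T = ∀ n (i : Fin (ℓ n)) → ∃[ j ] par n j ≡ i
  where open PlaneTree T

module Planarity (T : PlaneTree) where
  open PlaneTree T
  open Ancestry T

  LeftOf : Node T → Node T → Set
  LeftOf x y = lay x ≡ lay y × suc (pos x) ≡ pos y

  leftOf? : ∀ x y → Dec (LeftOf x y)
  leftOf? x y = (lay x ℕ.≟ lay y) ×-dec (suc (pos x) ℕ.≟ pos y)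

  LeftOf-injectiveˡ : ∀ {x x′ y} → LeftOf x y → LeftOf x′ y → x ≡ x′
  LeftOf-injectiveˡ (lay≡ , pos≡) (lay≡′ , pos≡′) =
    node-≡ (trans lay≡ (sym lay≡′)) (suc-injective (trans pos≡ (sym pos≡′)))

  LeftOf-injectiveʳ : ∀ {x y y′} → LeftOf x y → LeftOf x y′ → y ≡ y′
  LeftOf-injectiveʳ (lay≡ , pos≡) (lay≡′ , pos≡′) =
    node-≡ (trans (sym lay≡) lay≡′) (trans (sym pos≡) pos≡′)

  Near : Node T → Node T → Set
  Near x y = lay x ≡ lay y × pos x ≤ pos y × pos y ≤ suc (pos x)

  LeftOf⇒Near : ∀ {x y} → LeftOf x y → Near x y
  LeftOf⇒Near (lay≡ , pos≡) = lay≡ , ≤-trans (n≤1+n _) (≤-reflexive pos≡) , ≤-reflexive (sym pos≡)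

  Near⇒≡⊎LeftOf : ∀ {x y} → Near x y → x ≡ y ⊎ LeftOf x y
  Near⇒≡⊎LeftOf (lay≡ , x≤y , y≤x+1) with m≤n⇒m<n∨m≡n x≤y
  ... | inj₁ x<y = inj₂ (lay≡ , ≤-antisym x<y y≤x+1)
  ... | inj₂ x≡y = inj₁ (node-≡ lay≡ x≡y)

  module _ (leafless : Leafless T) where

    -- a node strictly between the parents of two neighbours would have no child
    par-near : ∀ m (i j : Fin (ℓ (suc m))) → toℕ i ≤ toℕ j → toℕ j ≤ suc (toℕ i) →
      toℕ (par m j) ≤ suc (toℕ (par m i))
    par-near m i j i≤j j≤i+1 with toℕ (par m j) ≤? suc (toℕ (par m i))
    ... | yes near = near
    ... | no  gap  = contradiction (leafless m c) childless
      where
      pi+2≤pj : suc (suc (toℕ (par m i))) ≤ toℕ (par m j)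
      pi+2≤pj = ≰⇒> gap
      c<ℓ : suc (toℕ (par m i)) < ℓ m
      c<ℓ = ≤-trans pi+2≤pj (<⇒≤ (toℕ<n (par m j)))
      c = Fin.fromℕ< c<ℓ
      pos-c : ∀ {j′} → par m j′ ≡ c → toℕ (par m j′) ≡ suc (toℕ (par m i))
      pos-c pj′≡c = trans (cong toℕ pj′≡c) (toℕ-fromℕ< c<ℓ)
      childless : ¬ (∃[ j′ ] par m j′ ≡ c)
      childless (j′ , pj′≡c) with toℕ j′ ≤? toℕ i
      ... | yes j′≤i = 1+n≰n (≤-trans (≤-reflexive (sym (pos-c pj′≡c))) (par-mono m j′ i j′≤i))
      ... | no  j′≰i = 1+n≰n (≤-trans pi+2≤pj (≤-trans (par-mono m j j′ (≤-trans j≤i+1 (≰⇒> j′≰i)))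
                                                        (≤-reflexive (pos-c pj′≡c))))

    parent-near : ∀ {x y} → Near x y → Near (parent x) (parent y)
    parent-near {zero  , i} {.zero  , j} (refl , i≤j , j≤i+1) = refl , i≤j , j≤i+1
    parent-near {suc m , i} {.suc m , j} (refl , i≤j , j≤i+1) =
      refl , par-mono m i j i≤j , par-near m i j i≤j j≤i+1

    iter-near : ∀ j {x y} → Near x y → Near (iter T j x) (iter T j y)
    iter-near zero    near = near
    iter-near (suc j) near = parent-near (iter-near j near)

    anc-near : ∀ n {x y} → Near x y → Near (anc n x) (anc n y)
    anc-near n {x} {y} near@(lay≡ , _) =
      subst (λ l → Near (anc n x) (iter T (l ∸ n) y)) lay≡ (iter-near (lay x ∸ n) near)


-- The frontier of a partially contracted tree

module Frontier (T : PlaneTree) where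
  open PlaneTree T
  open Ancestry T
  open Planarity T

  -- the node representing z once the layers below n, and the nodes of layer n left of
  -- position p, have been contracted into their parents
  frontier : ℕ → ℕ → Node T → Node T
  frontier n p z with lay z <? n | p ≤? pos (anc n z)
  ... | yes _ | _     = z
  ... | no  _ | yes _ = anc n z
  ... | no  _ | no  _ = parent (anc n z)

  data FrontierView (n p : ℕ) (z : Node T) : Node T → Set where
    above  : lay z < n → FrontierView n p z z
    on     : n ≤ lay z → p ≤ pos (anc n z) → FrontierView n p z (anc n z)
    lifted : n ≤ lay z → pos (anc n z) < p → FrontierView n p z (parent (anc n z))

  frontierView : ∀ n p z → FrontierView n p z (frontier n p z)
  frontierView n p z with lay z <? n | p ≤? pos (anc n z)
  ... | yes z<n | _      = above z<n
  ... | no  z≮n | yes p≤ = on (≮⇒≥ z≮n) p≤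
  ... | no  z≮n | no  p≰ = lifted (≮⇒≥ z≮n) (≰⇒> p≰)

  frontier-≼ : ∀ n p z → frontier n p z ≼ z
  frontier-≼ n p z with frontier n p z | frontierView n p z
  ... | _ | above _    = ≼-refl
  ... | _ | on _ _     = anc-≼ n z
  ... | _ | lifted _ _ = ≼-trans (parent-≼ (anc n z)) (anc-≼ n z)

  frontier-above : ∀ {n p z} → lay z < n → frontier n p z ≡ z
  frontier-above {n} {p} {z} z<n with frontier n p z | frontierView n p z
  ... | _ | above _     = refl
  ... | _ | on n≤ _     = contradiction n≤ (<⇒≱ z<n)
  ... | _ | lifted n≤ _ = contradiction n≤ (<⇒≱ z<n)

  frontier-bottom : ∀ {N z} → lay z ≤ N → frontier N 0 z ≡ z
  frontier-bottom {N} {z} z≤N with frontier N 0 z | frontierView N 0 z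
  ... | _ | above _     = refl
  ... | _ | on N≤ _     = anc-self z (≤-antisym z≤N N≤)
  ... | _ | lifted _ ()

  lay-frontier-0 : ∀ p z → lay (frontier 0 p z) ≡ 0
  lay-frontier-0 p z with frontier 0 p z | frontierView 0 p z
  ... | _ | on _ _     = lay-anc z z≤n
  ... | _ | lifted _ _ = lay-parent-anc z z≤n

  module _ {n p : ℕ} (p<ℓ : p < ℓ (suc n)) where

    private
      w : Node T
      w = suc n , Fin.fromℕ< p<ℓ

    frontier-advance : ∀ z →
        (frontier (suc n) p z ≡ w × frontier (suc n) (suc p) z ≡ parent w)
      ⊎ (frontier (suc n) p z ≢ w × frontier (suc n) (suc p) z ≡ frontier (suc n) p z)
    frontier-advance z with frontier (suc n) p z | frontierView (suc n) p z
                          | frontier (suc n) (suc p) z | frontierView (suc n) (suc p) z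
    ... | _ | above z<    | _ | above _     = inj₂ ((λ z≡w → <-irrefl (cong lay z≡w) z<) , refl)
    ... | _ | above z<    | _ | on n≤ _     = contradiction n≤ (<⇒≱ z<)
    ... | _ | above z<    | _ | lifted n≤ _ = contradiction n≤ (<⇒≱ z<)
    ... | _ | on n≤ _     | _ | above z<    = contradiction n≤ (<⇒≱ z<)
    ... | _ | lifted n≤ _ | _ | above z<    = contradiction n≤ (<⇒≱ z<)
    ... | _ | on _ _      | _ | on _ p<     =
      inj₂ ((λ a≡w → <-irrefl (sym (trans (cong pos a≡w) (toℕ-fromℕ< p<ℓ))) p<) , refl)
    ... | _ | on n≤ p≤    | _ | lifted _ <p+1 = inj₁ (a≡w , cong parent a≡w)
      where a≡w = node-≡ (lay-anc z n≤) (trans (≤-antisym (s≤s⁻¹ <p+1) p≤) (sym (toℕ-fromℕ< p<ℓ)))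
    ... | _ | lifted _ <p | _ | on _ p<     = contradiction (≤-trans (n≤1+n p) p<) (<⇒≱ <p)
    ... | _ | lifted n≤ _ | _ | lifted _ _  =
      inj₂ ((λ pa≡w → 1+n≰n (≤-reflexive (trans (cong lay (sym pa≡w)) (lay-parent-anc z n≤)))) , refl)

  frontier-layerEnd : ∀ {n p} → ¬ p < ℓ (suc n) → ∀ z → frontier (suc n) p z ≡ frontier n 0 z
  frontier-layerEnd {n} {p} p≮ℓ z with frontier (suc n) p z | frontierView (suc n) p z
                                     | frontier n 0 z | frontierView n 0 z
  ... | _ | above _       | _ | above _  = refl
  ... | _ | above z<      | _ | on n≤ _  = sym (anc-self z (≤-antisym (s≤s⁻¹ z<) n≤))
  ... | _ | _             | _ | lifted _ ()
  ... | _ | on n+1≤ p≤    | _ | _        = contradiction (≤-<-trans p≤ a<ℓ) p≮ℓ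
    where
    a<ℓ : pos (anc (suc n) z) < ℓ (suc n)
    a<ℓ = subst (λ l → pos (anc (suc n) z) < ℓ l) (lay-anc z n+1≤) (pos<ℓ (anc (suc n) z))
  ... | _ | lifted n+1≤ _ | _ | above z< = contradiction (≤-trans (n≤1+n n) n+1≤) (<⇒≱ z<)
  ... | _ | lifted n+1≤ _ | _ | on _ _   = parent-anc z n+1≤

  frontier-shared : ∀ {n p a b} → a ≼ b → n ≤ lay a → frontier n p b ≡ frontier n p a
  frontier-shared {n} {p} {a} {b} a≼b n≤a
    with frontier n p a | frontierView n p a | frontier n p b | frontierView n p b
  ... | _ | above a<    | _ | _           = contradiction n≤a (<⇒≱ a<)
  ... | _ | _           | _ | above b<    = contradiction (≤-trans n≤a (≼⇒lay≤ a≼b)) (<⇒≱ b<)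
  ... | _ | on _ _      | _ | on _ _      = anc-of-≼ n a≼b n≤a
  ... | _ | lifted _ _  | _ | lifted _ _  = cong parent (anc-of-≼ n a≼b n≤a)
  ... | _ | on _ p≤     | _ | lifted _ <p =
    contradiction (subst (λ x → p ≤ pos x) (sym (anc-of-≼ n a≼b n≤a)) p≤) (<⇒≱ <p)
  ... | _ | lifted _ <p | _ | on _ p≤     =
    contradiction (subst (λ x → p ≤ pos x) (anc-of-≼ n a≼b n≤a) p≤) (<⇒≱ <p)

  frontier-≺ : ∀ {n p a b} → a ≼ b → frontier n p a ≢ frontier n p b →
    a ≡ frontier n p a × frontier n p a ≼ frontier n p b
  frontier-≺ {n} {p} {a} {b} a≼b fa≢fb with <-≤-connex (lay a) n
  ... | inj₂ n≤a = contradiction (sym (frontier-shared a≼b n≤a)) fa≢fb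
  ... | inj₁ a<n =
    sym fa≡a , subst (_≼ frontier n p b) (sym fa≡a) (≼-between a≼b (frontier-≼ n p b) a≤fb)
    where
    fa≡a = frontier-above a<n
    a≤fb : lay a ≤ lay (frontier n p b)
    a≤fb with frontier n p b | frontierView n p b
    ... | _ | above _     = ≼⇒lay≤ a≼b
    ... | _ | on n≤ _     = subst (lay a ≤_) (sym (lay-anc b n≤)) (<⇒≤ a<n)
    ... | _ | lifted n≤ _ = subst (lay a ≤_) (sym (lay-parent-anc b n≤)) (pred-mono-≤ a<n)

  ParentOfLeft : Node T → Node T → Set
  ParentOfLeft g h = ∃[ i ] (LeftOf (lay g , i) g × parent (lay g , i) ≡ h)

  Cursor : ℕ → ℕ → Node T → Set
  Cursor n p h = lay h ≡ n × pos h ≡ p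

  -- the possible frontier nodes of a class red to a class with frontier node g
  data Close (n p : ℕ) (g : Node T) : Node T → Set where
    same         : Close n p g g
    left         : ∀ {h} → LeftOf h g → Close n p g h
    right        : ∀ {h} → LeftOf g h → Close n p g h
    parentOfLeft : ∀ {h} → ParentOfLeft g h → Close n p g h
    cursor       : ∀ {h} → Cursor n p h → Close n p g h

  parentOfLeft′ : ∀ {n p l g} → LeftOf l g → Close n p g (parent l)
  parentOfLeft′ {l = m , i} {.m , _} (refl , l<g) = parentOfLeft (i , (refl , l<g) , refl)

  module _ (leafless : Leafless T) where

    frontier-rightNeighbour : ∀ {n p a b} → LeftOf a b → Close n p (frontier n p a) (frontier n p b)
    frontier-rightNeighbour {n} {p} {a} {b} a<b@(lay≡ , _)
      with frontier n p a | frontierView n p a | frontier n p b | frontierView n p b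
    ... | _ | above _     | _ | above _     = right a<b
    ... | _ | above a<    | _ | on n≤ _     = contradiction (subst (n ≤_) (sym lay≡) n≤) (<⇒≱ a<)
    ... | _ | above a<    | _ | lifted n≤ _ = contradiction (subst (n ≤_) (sym lay≡) n≤) (<⇒≱ a<)
    ... | _ | on n≤ _     | _ | above b<    = contradiction (subst (n ≤_) lay≡ n≤) (<⇒≱ b<)
    ... | _ | lifted n≤ _ | _ | above b<    = contradiction (subst (n ≤_) lay≡ n≤) (<⇒≱ b<)
    ... | _ | on _ _      | _ | on _ _      with Near⇒≡⊎LeftOf (anc-near leafless n (LeftOf⇒Near a<b))
    ...   | inj₁ a≡b  = subst (Close n p _) a≡b same
    ...   | inj₂ a<b′ = right a<b′
    frontier-rightNeighbour {n} {p} {a} {b} a<b | _ | on _ p≤ | _ | lifted _ <p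
      with _ , a≤b , _ ← anc-near leafless n (LeftOf⇒Near a<b) = contradiction (≤-trans p≤ a≤b) (<⇒≱ <p)
    frontier-rightNeighbour {n} {p} {a} {b} a<b | _ | lifted _ <p | _ | on n≤ p≤
      with _ , _ , b≤a+1 ← anc-near leafless n (LeftOf⇒Near a<b) =
      cursor (lay-anc b n≤ , ≤-antisym (≤-trans b≤a+1 <p) p≤)
    frontier-rightNeighbour {n} {p} {a} {b} a<b | _ | lifted _ _ | _ | lifted _ _
      with Near⇒≡⊎LeftOf (parent-near leafless (anc-near leafless n (LeftOf⇒Near a<b)))
    ...   | inj₁ a≡b  = subst (Close n p _) a≡b same
    ...   | inj₂ a<b′ = right a<b′

    frontier-leftNeighbour : ∀ {n p a b} → LeftOf b a → Close n p (frontier n p a) (frontier n p b)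
    frontier-leftNeighbour {n} {p} {a} {b} b<a@(lay≡ , _)
      with frontier n p a | frontierView n p a | frontier n p b | frontierView n p b
    ... | _ | above _     | _ | above _     = left b<a
    ... | _ | above a<    | _ | on n≤ _     = contradiction (subst (n ≤_) lay≡ n≤) (<⇒≱ a<)
    ... | _ | above a<    | _ | lifted n≤ _ = contradiction (subst (n ≤_) lay≡ n≤) (<⇒≱ a<)
    ... | _ | on n≤ _     | _ | above b<    = contradiction (subst (n ≤_) (sym lay≡) n≤) (<⇒≱ b<)
    ... | _ | lifted n≤ _ | _ | above b<    = contradiction (subst (n ≤_) (sym lay≡) n≤) (<⇒≱ b<)
    ... | _ | on _ _      | _ | on _ _      with Near⇒≡⊎LeftOf (anc-near leafless n (LeftOf⇒Near b<a))
    ...   | inj₁ b≡a  = subst (Close n p _) (sym b≡a) same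
    ...   | inj₂ b<a′ = left b<a′
    frontier-leftNeighbour {n} {p} {a} {b} b<a | _ | on _ p≤ | _ | lifted _ <p
      with Near⇒≡⊎LeftOf (anc-near leafless n (LeftOf⇒Near b<a))
    ...   | inj₁ b≡a  = contradiction (subst (λ x → p ≤ pos x) (sym b≡a) p≤) (<⇒≱ <p)
    ...   | inj₂ b<a′ = parentOfLeft′ b<a′
    frontier-leftNeighbour {n} {p} {a} {b} b<a | _ | lifted _ <p | _ | on _ p≤
      with _ , b≤a , _ ← anc-near leafless n (LeftOf⇒Near b<a) = contradiction (≤-trans p≤ b≤a) (<⇒≱ <p)
    frontier-leftNeighbour {n} {p} {a} {b} b<a | _ | lifted _ _ | _ | lifted _ _
      with Near⇒≡⊎LeftOf (parent-near leafless (anc-near leafless n (LeftOf⇒Near b<a)))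
    ...   | inj₁ b≡a  = subst (Close n p _) (sym b≡a) same
    ...   | inj₂ b<a′ = left b<a′

  parentOfLeft? : ∀ g h → Dec (ParentOfLeft g h)
  parentOfLeft? g h = any? (λ i → leftOf? (lay g , i) g ×-dec (parent (lay g , i) ≟ₙ h))

  ParentOfLeft-functional : ∀ {g h h′} → ParentOfLeft g h → ParentOfLeft g h′ → h ≡ h′
  ParentOfLeft-functional (_ , i<g , refl) (_ , i′<g , refl) = cong parent (LeftOf-injectiveˡ i<g i′<g)

  cursor? : ∀ n p h → Dec (Cursor n p h)
  cursor? n p h = (lay h ℕ.≟ n) ×-dec (pos h ℕ.≟ p)

  closeCode : ℕ → ℕ → Node T → Node T → List Bool
  closeCode n p g h =
    does (h ≟ₙ g) ∷ does (leftOf? h g) ∷ does (leftOf? g h) ∷ does (parentOfLeft? g h) ∷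
    does (cursor? n p h) ∷ []

  closeCode-injective : ∀ {n p g h h′} → closeCode n p g h ≡ closeCode n p g h′ → Close n p g h → h ≡ h′
  closeCode-injective {n} {p} {g} {h} {h′} eq close with ≡⇒Pointwise-≡ eq | close
  ... | e ∷ _                 | same            = sym (does-transfer (g ≟ₙ g) (h′ ≟ₙ g) e refl)
  ... | _ ∷ e ∷ _             | left h<g        =
    LeftOf-injectiveˡ h<g (does-transfer (leftOf? h g) (leftOf? h′ g) e h<g)
  ... | _ ∷ _ ∷ e ∷ _         | right g<h       =
    LeftOf-injectiveʳ g<h (does-transfer (leftOf? g h) (leftOf? g h′) e g<h)
  ... | _ ∷ _ ∷ _ ∷ e ∷ _     | parentOfLeft pl =
    ParentOfLeft-functional pl (does-transfer (parentOfLeft? g h) (parentOfLeft? g h′) e pl)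
  ... | _ ∷ _ ∷ _ ∷ _ ∷ e ∷ _ | cursor at
    with lay≡′ , pos≡′ ← does-transfer (cursor? n p h) (cursor? n p h′) e at =
    node-≡ (trans (proj₁ at) (sym lay≡′)) (trans (proj₂ at) (sym pos≡′))

-- Contracting a layered wheel

module Contraction (W : LayeredWheel) (leafless : Leafless (LayeredWheel.tree W)) (ur : UpwardRestricted W)
                   (k : ℕ) (f : Fin k → Node (LayeredWheel.tree W))
                   (f-injective : ∀ a b → f a ≡ f b → a ≡ b) where
  open LayeredWheel W
  open PlaneTree tree
  open Ancestry tree
  open Planarity tree
  open Frontier tree

  adjᶠ : Fin k → Fin k → Bool
  adjᶠ a b = adj (f a) (f b)

  Agree : Node tree → Node tree → Node tree → Set
  Agree g z z′ = ∀ c → f c ≼ g → adj z (f c) ≡ adj z′ (f c)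

  Agree-parent : ∀ {w z z′} → Agree w z z′ → Agree (parent w) z z′
  Agree-parent agree c c≼pw = agree c (≼-trans c≼pw (parent-≼ _))

  Agree-extend : ∀ {w z z′} → adj z w ≡ adj z′ w → Agree (parent w) z z′ → Agree w z z′
  Agree-extend {z = z} {z′} adj≡ agree c c≼w with ≼-parent c≼w
  ... | inj₁ c≡w  = subst (λ v → adj z v ≡ adj z′ v) (sym c≡w) adj≡
  ... | inj₂ c≼pw = agree c c≼pw

  trace : Node tree → Node tree → List Bool
  trace g z = map (λ c → does (f c ≼? g) ∧ adj z (f c)) (allFin k)

  trace-≡⇒Agree : ∀ {g z z′} → trace g z ≡ trace g z′ → Agree g z z′
  trace-≡⇒Agree {g} eq c c≼g with map-≡⇒≡ eq (∈-allFin c)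
  ... | adj≡ with f c ≼? g
  ...   | yes _  = adj≡
  ...   | no c⋠g = contradiction c≼g c⋠g

  Agree⇒trace-≡ : ∀ {g z z′} → Agree g z z′ → trace g z ≡ trace g z′
  Agree⇒trace-≡ {g} {z} {z′} agree = map-cong bit (allFin k)
    where
    bit : ∀ c → (does (f c ≼? g) ∧ adj z (f c)) ≡ (does (f c ≼? g) ∧ adj z′ (f c))
    bit c with f c ≼? g
    ... | yes c≼g = agree c c≼g
    ... | no  _   = refl

  Key : Set
  Key = Node tree × Bool × List Bool

  _≟ᴷ_ : DecidableEquality Key
  _≟ᴷ_ = ≡-dec _≟ₙ_ (≡-dec Bool._≟_ (List.≡-dec Bool._≟_))

  keyAt : Node tree → Fin k → Key
  keyAt g x = g , does (f x ≟ₙ g) , trace g (f x)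

  key : ℕ → ℕ → Fin k → Key
  key n p x = keyAt (frontier n p (f x)) x

  module _ {g g′ : Node tree} {x y : Fin k} (eq : keyAt g x ≡ keyAt g′ y) where

    keyAt-≡⇒≡ : g ≡ g′
    keyAt-≡⇒≡ = cong proj₁ eq

    keyAt-≡⇒flag : does (f x ≟ₙ g) ≡ does (f y ≟ₙ g′)
    keyAt-≡⇒flag = cong (proj₁ ∘ proj₂) eq

    keyAt-≡⇒Agree : Agree g (f x) (f y)
    keyAt-≡⇒Agree with refl ← keyAt-≡⇒≡ = trace-≡⇒Agree (cong (proj₂ ∘ proj₂) eq)

  keyAt-≡ : ∀ {g x y} → does (f x ≟ₙ g) ≡ does (f y ≟ₙ g) → Agree g (f x) (f y) → keyAt g x ≡ keyAt g y
  keyAt-≡ {g} flag≡ agree = cong₂ (λ b t → g , b , t) flag≡ (Agree⇒trace-≡ agree)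

  keyAt-subst : ∀ {g₁ g₂ g₁′ g₂′ x y} → g₁ ≡ g₂ → g₁′ ≡ g₂′ →
    keyAt g₁ x ≡ keyAt g₁′ y → keyAt g₂ x ≡ keyAt g₂′ y
  keyAt-subst refl refl eq = eq

  module _ {n p : ℕ} (p<ℓ : p < ℓ (suc n)) where

    private
      w : Node tree
      w = suc n , Fin.fromℕ< p<ℓ

      fr : ℕ → Fin k → Node tree
      fr q y = frontier (suc n) q (f y)

      ≢parent-w : ∀ y → fr p y ≡ w → f y ≢ parent w
      ≢parent-w y y↦w y≡pw = 1+n≰n (begin
        suc n         ≡⟨ cong lay (sym y↦w) ⟩
        lay (fr p y)  ≤⟨ ≼⇒lay≤ (frontier-≼ (suc n) p (f y)) ⟩
        lay (f y)     ≡⟨ cong lay y≡pw ⟩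
        n             ∎)
        where open ≤-Reasoning

    key-advance : ∀ {x y} → key (suc n) p x ≡ key (suc n) p y → key (suc n) (suc p) x ≡ key (suc n) (suc p) y
    key-advance {x} {y} eq with frontier-advance p<ℓ (f x) | frontier-advance p<ℓ (f y)
    ... | inj₂ (_ , x-stays) | inj₂ (_ , y-stays) = keyAt-subst (sym x-stays) (sym y-stays) eq
    ... | inj₁ (x↦w , _)     | inj₂ (y↛w , _)     = contradiction (trans (sym (keyAt-≡⇒≡ eq)) x↦w) y↛w
    ... | inj₂ (x↛w , _)     | inj₁ (y↦w , _)     = contradiction (trans (keyAt-≡⇒≡ eq) y↦w) x↛w
    ... | inj₁ (x↦w , x↦pw)  | inj₁ (y↦w , y↦pw)  = keyAt-subst (sym x↦pw) (sym y↦pw) (keyAt-≡ flags agree)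
      where
      flags = trans (dec-false (f x ≟ₙ parent w) (≢parent-w x x↦w))
                    (sym (dec-false (f y ≟ₙ parent w) (≢parent-w y y↦w)))
      agree = Agree-parent (subst (λ g → Agree g (f x) (f y)) x↦w (keyAt-≡⇒Agree eq))

    -- the information lost when w is contracted into its parent
    advanceCode : Fin k → List Bool
    advanceCode y = does (fr p y ≟ₙ w) ∷ does (f y ≟ₙ fr p y) ∷ adj (f y) w ∷ []

    advanceCode-separates : ∀ {x y} → key (suc n) (suc p) x ≡ key (suc n) (suc p) y →
      advanceCode x ≡ advanceCode y → key (suc n) p x ≡ key (suc n) p y
    advanceCode-separates {x} {y} eq codes≡
      with moved≡ ∷ flag≡ ∷ adj≡ ∷ [] ← ≡⇒Pointwise-≡ codes≡
      with frontier-advance p<ℓ (f x) | frontier-advance p<ℓ (f y)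
    ... | inj₂ (_ , x-stays) | inj₂ (_ , y-stays) = keyAt-subst x-stays y-stays eq
    ... | inj₁ (x↦w , _)     | inj₂ (y↛w , _)     =
      contradiction (does-transfer (fr p x ≟ₙ w) (fr p y ≟ₙ w) moved≡ x↦w) y↛w
    ... | inj₂ (x↛w , _)     | inj₁ (y↦w , _)     =
      contradiction (does-transfer (fr p y ≟ₙ w) (fr p x ≟ₙ w) (sym moved≡) y↦w) x↛w
    ... | inj₁ (x↦w , x↦pw)  | inj₁ (y↦w , y↦pw)  = keyAt-subst (sym x↦w) (sym y↦w) (keyAt-≡ flags agree)
      where
      flags = subst₂ (λ g g′ → does (f x ≟ₙ g) ≡ does (f y ≟ₙ g′)) x↦w y↦w flag≡
      agree = Agree-extend adj≡ (keyAt-≡⇒Agree (keyAt-subst x↦pw y↦pw eq))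

  key-layerEnd : ∀ {n p} → ¬ p < ℓ (suc n) → ∀ x → key (suc n) p x ≡ key n 0 x
  key-layerEnd p≮ℓ x = cong (λ g → keyAt g x) (frontier-layerEnd p≮ℓ (f x))

  rootCode : ℕ → Fin k → List Bool
  rootCode p y = does (f y ≟ₙ frontier 0 p (f y)) ∷ adj (f y) (frontier 0 p (f y)) ∷ []

  rootCode-separates : ∀ {p a b} → rootCode p a ≡ rootCode p b → key 0 p a ≡ key 0 p b
  rootCode-separates {p} {a} {b} codes≡ with flag≡ ∷ adj≡ ∷ [] ← ≡⇒Pointwise-≡ codes≡ =
    keyAt-subst refl ra≡rb (keyAt-≡ (trans flag≡ (cong (λ g → does (f b ≟ₙ g)) (sym ra≡rb))) agree)
    where
    ra = frontier 0 p (f a)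
    ra≡rb = lay≡0⇒≡ (lay-frontier-0 p (f a)) (lay-frontier-0 p (f b))
    agree : Agree ra (f a) (f b)
    agree c c≼ra = subst (λ v → adj (f a) v ≡ adj (f b) v) (sym c≡ra) (trans adj≡ (cong (adj (f b)) (sym ra≡rb)))
      where
      lay≡0 = n≤0⇒n≡0 (subst (lay (f c) ≤_) (lay-frontier-0 p (f a)) (≼⇒lay≤ c≼ra))
      c≡ra = ≼∧lay≡⇒≡ c≼ra (trans lay≡0 (sym (lay-frontier-0 p (f a))))

  data Stage : Set where
    at   : ℕ → ℕ → Stage
    done : Stage

  next : Stage → Stage
  next (at zero    p) = done
  next (at (suc n) p) with p <? ℓ (suc n)
  ... | yes _ = at (suc n) (suc p)
  ... | no  _ = at n 0
  next done = done

  Same : Stage → Fin k → Fin k → Set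
  Same (at n p) x y = key n p x ≡ key n p y
  Same done     _ _ = ⊤

  Same-isDecEquivalence : ∀ st → IsDecEquivalence (Same st)
  Same-isDecEquivalence (at n p) = On.isDecEquivalence (key n p) (≡.isDecEquivalence _≟ᴷ_)
  Same-isDecEquivalence done     = record
    { isEquivalence = record { refl = tt ; sym = λ _ → tt ; trans = λ _ _ → tt }
    ; _≟_           = λ _ _ → yes tt
    }

  next-coarsens : ∀ st {x y} → Same st x y → Same (next st) x y
  next-coarsens (at zero    p) _ = tt
  next-coarsens (at (suc n) p) {x} {y} eq with p <? ℓ (suc n)
  ... | yes p<ℓ = key-advance p<ℓ eq
  ... | no  p≮ℓ = trans (sym (key-layerEnd p≮ℓ x)) (trans eq (key-layerEnd p≮ℓ y))
  next-coarsens done _ = tt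

  split-bound : ∀ st x L → AllPairs (λ a b → ¬ Same st a b) L → All (Same (next st) x) L → length L ≤ 8
  split-bound (at zero p) x L ≁L _ =
    ≤-trans (length≤2^-of-code {Q = λ _ → ⊤} (rootCode p) (λ _ → refl) (λ _ _ → rootCode-separates {p})
                               (All.tabulate (λ _ → tt)) ≁L)
            (^-monoʳ-≤ 2 (n≤1+n 2))
  split-bound (at (suc n) p) x L ≁L with p <? ℓ (suc n)
  ... | yes p<ℓ = λ x~L → length≤2^-of-code (advanceCode p<ℓ) (λ _ → refl)
                              (λ x~a x~b → advanceCode-separates p<ℓ (trans (sym x~a) x~b)) x~L ≁L
  ... | no  p≮ℓ = λ x~L → ≤-trans (length≤2^-of-code (λ _ → []) (λ _ → refl) unchanged x~L ≁L) (s≤s z≤n)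
    where
    unchanged : ∀ {a b} → key n 0 x ≡ key n 0 a → key n 0 x ≡ key n 0 b → [] ≡ [] →
      key (suc n) p a ≡ key (suc n) p b
    unchanged {a} {b} x~a x~b _ = trans (key-layerEnd p≮ℓ a) (trans (trans (sym x~a) x~b) (sym (key-layerEnd p≮ℓ b)))
  split-bound done x L ≁L x~L =
    ≤-trans (length≤2^-of-code (λ _ → []) (λ _ → refl) (λ _ _ _ → tt) x~L ≁L) (s≤s z≤n)

  layer-edge : ∀ {a b} → adj a b ≡ true → lay a ≡ lay b → LeftOf a b ⊎ LeftOf b a
  layer-edge {m , i} {.m , j} ab refl = Sum.map (refl ,_) (refl ,_) (Equivalence.to (layer-path m i j) ab)

  -- if u lies above the frontier, its key fixes u itself and the key of u′ fixes adjacency to it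
  adj-homogeneous : ∀ {n p u v u′ v′} → key n p u ≡ key n p v → key n p u′ ≡ key n p v′ →
    f u ≼ f u′ → frontier n p (f u) ≢ frontier n p (f u′) → adj (f u) (f u′) ≡ adj (f v) (f v′)
  adj-homogeneous {n} {p} {u} {v} {u′} {v′} uv u′v′ u≼u′ gu≢gu′ = begin
    adj (f u) (f u′)  ≡⟨ adj-sym (f u) (f u′) ⟩
    adj (f u′) (f u)  ≡⟨ keyAt-≡⇒Agree u′v′ u (subst (_≼ frontier n p (f u′)) (sym u≡gu) gu≼gu′) ⟩
    adj (f v′) (f u)  ≡⟨ cong (adj (f v′)) u≡v ⟩
    adj (f v′) (f v)  ≡⟨ adj-sym (f v′) (f v) ⟩
    adj (f v) (f v′)  ∎
    where
    open ≡-Reasoning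
    u≡gu : f u ≡ frontier n p (f u)
    u≡gu = proj₁ (frontier-≺ {n} {p} u≼u′ gu≢gu′)
    gu≼gu′ : frontier n p (f u) ≼ frontier n p (f u′)
    gu≼gu′ = proj₂ (frontier-≺ {n} {p} u≼u′ gu≢gu′)
    v≡gv : f v ≡ frontier n p (f v)
    v≡gv = does-transfer (f u ≟ₙ frontier n p (f u)) (f v ≟ₙ frontier n p (f v)) (keyAt-≡⇒flag uv) u≡gu
    u≡v : f u ≡ f v
    u≡v = trans u≡gu (trans (keyAt-≡⇒≡ uv) (sym v≡gv))

  redPair⇒close : ∀ {n p x y} → RedPair adjᶠ (Same (at n p)) x y →
    Close n p (frontier n p (f x)) (frontier n p (f y))
  redPair⇒close {n} {p} {x} {y} (_ , u , v , u′ , v′ , xu , xv , yu′ , yv′ , uu′ , vv′) =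
    close (frontier n p (f y) ≟ₙ frontier n p (f x))
    where
    gx = frontier n p (f x)
    gy = frontier n p (f y)
    close : Dec (gy ≡ gx) → Close n p gx gy
    close (yes gy≡gx) = subst (Close n p gx) (sym gy≡gx) same
    close (no  gy≢gx) =
      subst₂ (Close n p) (sym (keyAt-≡⇒≡ xu)) (sym (keyAt-≡⇒≡ yu′)) (edge-close (lay (f u) ℕ.≟ lay (f u′)))
      where
      uv : key n p u ≡ key n p v
      uv = trans (sym xu) xv
      u′v′ : key n p u′ ≡ key n p v′
      u′v′ = trans (sym yu′) yv′
      gu≢gu′ : frontier n p (f u) ≢ frontier n p (f u′)
      gu≢gu′ gu≡gu′ = gy≢gx (trans (keyAt-≡⇒≡ yu′) (trans (sym gu≡gu′) (sym (keyAt-≡⇒≡ xu))))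
      up-edge : f u ≼ f u′ → adj (f u) (f u′) ≡ adj (f v) (f v′)
      up-edge u≼u′ = adj-homogeneous {n} {p} {u} {v} {u′} {v′} uv u′v′ u≼u′ gu≢gu′
      down-edge : f u′ ≼ f u → adj (f u) (f u′) ≡ adj (f v) (f v′)
      down-edge u′≼u = trans (adj-sym (f u) (f u′))
        (trans (adj-homogeneous {n} {p} {u′} {v′} {u} {v} u′v′ uv u′≼u (gu≢gu′ ∘ sym)) (adj-sym (f v′) (f v)))
      edge-close : Dec (lay (f u) ≡ lay (f u′)) → Close n p (frontier n p (f u)) (frontier n p (f u′))
      edge-close (yes lay≡) =
        Sum.[ frontier-rightNeighbour leafless , frontier-leftNeighbour leafless ]′ (layer-edge uu′ lay≡)
      edge-close (no  lay≢) = contradiction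
        (trans (sym uu′) (trans (Sum.[ up-edge , down-edge ]′ (nonlayer-anc (f u) (f u′) uu′ lay≢)) vv′)) λ ()

  t : ℕ
  t = proj₁ ur

  X : Node tree → List (Node tree)
  X g = proj₁ (proj₂ ur g)

  length-X : ∀ g → length (X g) ≤ t
  length-X g = proj₁ (proj₂ (proj₂ ur g))

  X-exits : ∀ g {z y} → adj z y ≡ true → lay z ≢ lay y → g ≼ z → ¬ g ≼ y → y ∈ X g
  X-exits g = proj₂ (proj₂ (proj₂ (proj₂ ur g))) _ _

  -- padded to length t + 1 so that all red codes below have one length
  watch : Node tree → List (Node tree)
  watch g = g ∷ X g ++ replicate (t ∸ length (X g)) g

  length-watch : ∀ g → length (watch g) ≡ suc t
  length-watch g = cong suc (begin
    length (X g ++ replicate (t ∸ length (X g)) g)          ≡⟨ length-++ (X g) ⟩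
    length (X g) + length (replicate (t ∸ length (X g)) g)  ≡⟨ cong (length (X g) +_) (length-replicate _) ⟩
    length (X g) + (t ∸ length (X g))                       ≡⟨ m+[n∸m]≡n (length-X g) ⟩
    t                                                       ∎)
    where open ≡-Reasoning

  ∈-watch : ∀ {g y v} → g ≼ y → v ≼ g → v ≢ g → adj y v ≡ true → v ∈ watch g
  ∈-watch {g} {y} {v} g≼y v≼g v≢g yv = there (∈-++⁺ˡ (X-exits g yv
      (λ y≡v → <⇒≱ v<g (≤-trans (≼⇒lay≤ g≼y) (≤-reflexive y≡v)))
      g≼y (λ g≼v → <⇒≱ v<g (≼⇒lay≤ g≼v))))
    where
    v<g : lay v < lay g
    v<g = ≤∧≢⇒< (≼⇒lay≤ v≼g) (v≢g ∘ ≼∧lay≡⇒≡ v≼g)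

  Agree-of-watch : ∀ {g z z′} → g ≼ z → g ≼ z′ →
    map (adj z) (watch g) ≡ map (adj z′) (watch g) → Agree g z z′
  Agree-of-watch {g} {z} {z′} g≼z g≼z′ eq c c≼g with f c ≟ₙ g
  ... | yes c≡g = map-≡⇒≡ eq (here c≡g)
  ... | no  c≢g with adj z (f c) in zc | adj z′ (f c) in z′c
  ...   | false | false = refl
  ...   | true  | _     = trans (sym zc) (trans (map-≡⇒≡ eq (∈-watch g≼z c≼g c≢g zc)) z′c)
  ...   | false | true  = trans (sym zc) (trans (map-≡⇒≡ eq (∈-watch g≼z′ c≼g c≢g z′c)) z′c)

  redCode : ℕ → ℕ → Fin k → Fin k → List Bool
  redCode n p x y = closeCode n p (frontier n p (f x)) gy ++ does (f y ≟ₙ gy) ∷ map (adj (f y)) (watch gy)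
    where gy = frontier n p (f y)

  length-redCode : ∀ n p x y → length (redCode n p x y) ≡ 7 + t
  length-redCode n p x y = cong (6 +_) (trans (length-map _ (watch gy)) (length-watch gy))
    where gy = frontier n p (f y)

  redCode-separates : ∀ {n p x a b} → RedPair adjᶠ (Same (at n p)) x a → RedPair adjᶠ (Same (at n p)) x b →
    redCode n p x a ≡ redCode n p x b → key n p a ≡ key n p b
  redCode-separates {n} {p} {x} {a} {b} xa _ codes≡ = keyAt-subst refl ga≡gb (keyAt-≡ flags agree)
    where
    ga = frontier n p (f a)
    gb = frontier n p (f b)
    ga≡gb : ga ≡ gb
    ga≡gb = closeCode-injective (cong (take 5) codes≡) (redPair⇒close {n} {p} {x} {a} xa)
    rest≡ : does (f a ≟ₙ ga) ∷ map (adj (f a)) (watch ga) ≡ does (f b ≟ₙ gb) ∷ map (adj (f b)) (watch gb)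
    rest≡ = cong (drop 5) codes≡
    flags : does (f a ≟ₙ ga) ≡ does (f b ≟ₙ ga)
    flags = trans (proj₁ (∷-injective rest≡)) (cong (λ g → does (f b ≟ₙ g)) (sym ga≡gb))
    agree : Agree ga (f a) (f b)
    agree = Agree-of-watch (frontier-≼ n p (f a)) (subst (_≼ f b) (sym ga≡gb) (frontier-≼ n p (f b)))
      (trans (proj₂ (∷-injective rest≡)) (cong (λ g → map (adj (f b)) (watch g)) (sym ga≡gb)))

  red-bound : ∀ st x L → AllPairs (λ a b → ¬ Same st a b) L → All (RedPair adjᶠ (Same st) x) L →
    length L ≤ 2 ^ (7 + t)
  red-bound (at n p) x L ≁L reds =
    length≤2^-of-code (redCode n p x) (length-redCode n p x) (redCode-separates {n} {p} {x}) reds ≁L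
  red-bound done x []      _ []              = z≤n
  red-bound done x (_ ∷ _) _ ((x≁y , _) ∷ _) = contradiction tt x≁y

  next-reaches-done : ∀ n p → ∃[ j ] iterate next (next (at n p)) j ≡ done
  next-reaches-done zero    _ = 0 , refl
  next-reaches-done (suc n) p = along-layer (ℓ (suc n) ∸ p) p ≤-refl
    where
    along-layer : ∀ d p → ℓ (suc n) ∸ p ≤ d → ∃[ j ] iterate next (next (at (suc n) p)) j ≡ done
    along-layer zero p ℓ∸p≤0 with p <? ℓ (suc n)
    ... | yes p<ℓ = contradiction ℓ∸p≤0 (<⇒≱ (m<n⇒0<n∸m p<ℓ))
    ... | no  _   = Prod.map suc id (next-reaches-done n 0)
    along-layer (suc d) p ℓ∸p≤d with p <? ℓ (suc n)
    ... | yes p<ℓ = Prod.map suc id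
      (along-layer d (suc p) (s≤s⁻¹ (subst (_≤ suc d) (n<m⇒m∸n≡1+[m∸1+n] p<ℓ) ℓ∸p≤d)))
    ... | no  _   = Prod.map suc id (next-reaches-done n 0)

  N : ℕ
  N = max 0 (map (lay ∘ f) (allFin k))

  lay≤N : ∀ a → lay (f a) ≤ N
  lay≤N a = All.lookup (xs≤max 0 (map (lay ∘ f) (allFin k))) (∈-map⁺ (lay ∘ f) (∈-allFin a))

  stage : ℕ → Stage
  stage = fold (at N 0) next

  stage-reaches-done : ∃[ s ] stage s ≡ done
  stage-reaches-done with j , reached ← next-reaches-done N 0 =
    suc j , trans (iterate-is-fold (at N 0) next (suc j)) reached

  chain : RefiningChain k adjᶠ 8 (2 ^ (7 + t))
  chain = record
    { E                = Same ∘ stage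
    ; isDecEquivalence = Same-isDecEquivalence ∘ stage
    ; E₀⇒≡             = λ {a} {b} eq → f-injective a b (begin
        f a                 ≡⟨ sym (frontier-bottom (lay≤N a)) ⟩
        frontier N 0 (f a)  ≡⟨ keyAt-≡⇒≡ {frontier N 0 (f a)} {frontier N 0 (f b)} {a} {b} eq ⟩
        frontier N 0 (f b)  ≡⟨ frontier-bottom (lay≤N b) ⟩
        f b                 ∎)
    ; E-step           = next-coarsens ∘ stage
    ; height           = proj₁ stage-reaches-done
    ; E-height         = λ _ _ → subst (λ st → Same st _ _) (sym (proj₂ stage-reaches-done)) tt
    ; split-bound      = split-bound ∘ stage
    ; red-bound        = red-bound ∘ stage
    }
    where open ≡-Reasoning

theorem1p14 : (W : LayeredWheel) → Neat W → UpwardRestricted W →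
    FiniteInducedBoundedTww W
theorem1p14 W neat ur = 8 + 2 ^ (7 + proj₁ ur) * 8 , λ k f f-injective →
  refiningChain⇒twinWidth≤ (Contraction.chain W neat ur k f f-injective)
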